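{- Let $S_1$ and $S_2$ be HRAM nets that are structurally equivalent. Then $[\![S_1]\!] =_{\mathbb A} [\![S_2]\!]$.
   Context: Port names and interfaces. Fix disjoint countably infinite sets $\mathbb A$ (port names) and $\mathbb P$ (pointer names). Polarities are $L=\{O,P\}$ with $O^*=P$, $P^*=O$. A port is a pair $(l,a)\in L\times\mathbb A$. An interface is a finite set $A$ of ports in which no port name occurs twice; $\mathrm{sup}(A)$ is its set of port names, and $A^{(O)}$, $A^{(P)}$ are its subsets of $O$- and $P$-labelled ports. For interfaces with disjoint supports $A\otimes B=A\cup B$; $A^*=\{(l^*,a)\mid (l,a)\in A\}$; $A\Rightarrow B=A^*\otimes B$. For a permutation $\pi$ of $\mathbb A$, $\pi\vdash A_1=_{\mathbb A}A_2$ means $\{(l,\pi(a))\mid(l,a)\in A_1\}=A_2$. Machines. Data are $\mathcal D=\{\emptyset\}\cup\mathbb P\cup\mathbb Z$. Fix numbers $r_m\le r$. Instructions (register indices in $\mathbb N\cup\{\emptyset\}$; writing to $\emptyset$ discards, reading $\emptyset$ gives $\emptyset$): $i\leftarrow\mathtt{new}\ j,k$ (allocate a pointer $p$ not in the heap's domain, map it to $(d_j,d_k)$, store $p$ in register $i$); $i,j\leftarrow\mathtt{get}\ k$ (read the pair pointed to by $d_k$ into registers $i,j$); $\mathtt{update}\ i,j$ (set the second component of the pair pointed to by $d_i$ to $d_j$); $\mathtt{free}\ i$ (deallocate $d_i$ and reset register $i$ to $\emptyset$); $\mathtt{flip}\ i,j$ (swap registers $i,j$); $i\leftarrow\mathtt{set}\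 j$ (store constant $j$ in register $i$). Code fragments: $c::=\iota;c\mid\mathtt{ifzero}\ i\ c\ c\mid\mathtt{spark}\ a\mid\mathtt{end}$ with $\iota$ an instruction and $a\in\mathbb A$. An engine $E=(A,P)$ is an interface $A$ with a map $P$ from $\mathrm{sup}(A^{(O)})$ to code fragments such that every $a$ occurring in some $\mathtt{spark}\ a$ in the range of $P$ satisfies $(P,a)\in A$. A thread is a code fragment with an $r$-tuple of data (registers $d_0,\dots,d_{r-1}$); an engine configuration is a finite set of threads and a heap (finite partial map from $\mathbb P$ to $\mathbb P\times\mathcal D$). A message is $(a,\vec d)\in\mathbb A\times\mathcal D^{r_m}$. Engine steps (relative to a connection map $\chi$ on port names): a thread executes its first instruction as described (silent step); $\mathtt{ifzero}\ i\ c_1\ c_2$ continues with $c_1$ if $d_i=0$ and with $c_2$ if $d_i$ is a positive integer, resetting register $i$ to $\emptyset$; $\mathtt{end}$ removes the thread; $\mathtt{spark}\ a$: if $(O,\chi(a))\in A$, the thread is silently replaced by a thread running $P(\chi(a))$ whose registers are the first $r_m$ registers of the old thread padded with $\emptyset$; otherwise the thread is removed and the engine emits output message $(\chi(a),(d_0,\dots,d_{r_m-1}))$. For $(O,a)\in A$ the engine can receive input message $(a,\vec d)$, adding a thread running $P(a)$ with registers $\vec d$ padded with $\emptyset$. Nets. An HRAM net is $S=(\vec E,\chi,A)$: a finite set $\vec E$ of engines whose interfaces have pairwise disjoint supports (and disjoint from $\mathrm{sup}(A)$), an external interface $A$, and a bijection $\chi:\mathrm{sup}(A^{(O)}\otimes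 A_{\vec E}^{(P)})\to\mathrm{sup}(A^{(P)}\otimes A_{\vec E}^{(O)})$, where $A_{\vec E}$ is the tensor of all engine interfaces. A net configuration is a configuration for each engine plus a finite multiset of pending messages; the initial one has no threads, empty heaps and no messages. Net steps: silent engine steps are silent; an engine output adds the message to the multiset (silent); an engine input consumes a matching pending message (silent); for $(P,a)\in A$ a pending message $(a,\vec d)$ can be removed with observable label $(P,(a,\vec d))$; for $(O,a)\in A$ there is an observable step labelled $(O,(a,\vec d))$ that adds $(\chi(a),\vec d)$ to the multiset. A trace over $A$ is a finite sequence of polarised messages $(l,(a,\vec d))$ with $a\in\mathrm{sup}(A)$. The denotation $[\![S]\!]$ is the set of traces $\alpha_1\cdots\alpha_n$ such that from the initial configuration there is a run performing observable steps $\alpha_1,\dots,\alpha_n$ in order, with any number of silent steps interspersed. For sets of traces, $T_1=_{\mathbb A}T_2$ means there is a permutation $\pi$ of $\mathbb A$ with $\{\pi\cdot s\mid s\in T_1\}=T_2$, where $\pi$ renames the port names of messages. Structural equivalence. Nets $f=(\vec E_f,\chi_f,I_f)$ and $g=(\vec E_g,\chi_g,I_g)$ are structurally equivalent if there is a permutation $\pi$ of $\mathbb A$ with $\pi\cdot\vec E_f=\vec E_g$ (renaming port names in interfaces and code), $\pi\vdash I_f=_{\mathbb A}I_g$, and $\chi_g\circ\pi=\pi\circ\chi_f$. -}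

module Defs where

open import Data.Nat using (ℕ; zero; suc; _≤_; _≡ᵇ_)
open import Data.Integer using (ℤ; +_)
open import Data.Fin using (Fin; toℕ; inject≤)
open import Data.Vec using (Vec; lookup; tabulate; toList; _[_]≔_)
open import Data.List using (List; []; _∷_; _++_; map; length; replicate)
open import Data.List.Membership.Propositional using (_∈_)
open import Data.List.Relation.Unary.AllPairs using (AllPairs)
open import Data.Maybe using (Maybe; just; nothing)
open import Data.Product using (Σ; ∃; ∃-syntax; _×_; _,_; proj₁; proj₂)
open import Data.Sum using (_⊎_)
open import Data.Bool using (if_then_else_)
open import Data.Empty using (⊥)
open import Relation.Nullary using (¬_)
open import Relation.Binary.PropositionalEquality using (_≡_)
open import Function.Bundles using (_↔_; Inverse)

-- Names: port names 𝔸 and pointer names ℙ (two separate countably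
-- infinite types, hence disjoint).

PortName : Set
PortName = ℕ

PtrName : Set
PtrName = ℕ

Perm : Set
Perm = PortName ↔ PortName

app : Perm → PortName → PortName
app π = Inverse.to π

unapp : Perm → PortName → PortName
unapp π = Inverse.from π

data Pol : Set where
  O P : Pol

_* : Pol → Pol
O * = P
P * = O

Port : Set
Port = Pol × PortName

-- An interface is a finite set of ports, represented by a list
-- (only membership matters).
Interface : Set
Interface = List Port

_∈sup_ : PortName → Interface → Set
a ∈sup A = ∃[ l ] ((l , a) ∈ A)

WFInterface : Interface → Set
WFInterface A = ∀ {l l' a} → (l , a) ∈ A → (l' , a) ∈ A → l ≡ l'

IfaceEq : Interface → Interface → Set
IfaceEq A B = (∀ p → p ∈ A → p ∈ B) × (∀ p → p ∈ B → p ∈ A)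

renPort : Perm → Port → Port
renPort π (l , a) = (l , app π a)

renI : Perm → Interface → Interface
renI π A = map (renPort π) A

_⊢_=𝔸_ : Perm → Interface → Interface → Set
π ⊢ A₁ =𝔸 A₂ = IfaceEq (renI π A₁) A₂

data Datum : Set where
  ∅   : Datum
  ptr : PtrName → Datum
  int : ℤ → Datum

-- Heaps: partial maps ℙ ⇀ ℙ × 𝒟 (reachable heaps are finite).
Heap : Set
Heap = PtrName → Maybe (PtrName × Datum)

emptyHeap : Heap
emptyHeap _ = nothing

_[_↦_] : Heap → PtrName → Maybe (PtrName × Datum) → Heap
(h [ p ↦ v ]) q = if p ≡ᵇ q then v else h q

padAt : List Datum → ℕ → Datum
padAt []       _       = ∅
padAt (x ∷ xs) zero    = x
padAt (x ∷ xs) (suc n) = padAt xs n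

module HRAM (r rm : ℕ) (rm≤r : rm ≤ r) where

  -- register indices: ℕ ∪ {∅}, with actual indices < r
  Reg : Set
  Reg = Maybe (Fin r)

  data Instr : Set where
    new    : Reg → Reg → Reg → Instr
    get    : Reg → Reg → Reg → Instr
    update : Reg → Reg → Instr
    free   : Reg → Instr
    flip   : Reg → Reg → Instr
    set    : Reg → ℤ → Instr

  infixr 5 _⨾_
  data Code : Set where
    _⨾_    : Instr → Code → Code
    ifzero : Reg → Code → Code → Code
    spark  : PortName → Code
    end    : Code

  SparksIn : PortName → Code → Set
  SparksIn a (ι ⨾ c)          = SparksIn a c
  SparksIn a (ifzero i c₁ c₂) = SparksIn a c₁ ⊎ SparksIn a c₂
  SparksIn a (spark b)        = a ≡ b
  SparksIn a end              = ⊥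

  renCode : Perm → Code → Code
  renCode π (ι ⨾ c)          = ι ⨾ renCode π c
  renCode π (ifzero i c₁ c₂) = ifzero i (renCode π c₁) (renCode π c₂)
  renCode π (spark a)        = spark (app π a)
  renCode π end              = end

  -- An engine: interface A and program map P; only the values of P on
  -- sup(A^(O)) are meaningful (cf. EngEq below).
  record Engine : Set where
    constructor engine
    field
      iface : Interface
      prog  : PortName → Code
  open Engine public

  WFEngine : Engine → Set
  WFEngine E = WFInterface (iface E)
             × (∀ a b → (O , a) ∈ iface E → SparksIn b (prog E a) → (P , b) ∈ iface E)

  EngEq : Engine → Engine → Set
  EngEq E F = IfaceEq (iface E) (iface F)
            × (∀ a → (O , a) ∈ iface E → prog E a ≡ prog F a)

  renEngine : Perm → Engine → Engine
  renEngine π E = engine (renI π (iface E)) (λ a → renCode π (prog E (unapp π a)))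

  EngSetEq : List Engine → List Engine → Set
  EngSetEq Es Fs = (∀ E → E ∈ Es → ∃[ F ] (F ∈ Fs × EngEq E F))
                 × (∀ F → F ∈ Fs → ∃[ E ] (E ∈ Es × EngEq E F))

  Regs : Set
  Regs = Vec Datum r

  read : Regs → Reg → Datum
  read ρ nothing  = ∅
  read ρ (just i) = lookup ρ i

  write : Regs → Reg → Datum → Regs
  write ρ nothing  _ = ρ
  write ρ (just i) d = ρ [ i ]≔ d

  takeM : Regs → Vec Datum rm
  takeM ρ = tabulate (λ i → lookup ρ (inject≤ i rm≤r))

  pad : Vec Datum rm → Regs
  pad d = tabulate (λ j → padAt (toList d) (toℕ j))

  Thread : Set
  Thread = Code × Regs

  Msg : Set
  Msg = PortName × Vec Datum rm

  data ELabel : Set where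
    τ   : ELabel
    out : Msg → ELabel
    inp : Msg → ELabel

  -- one step of a single thread; the resulting list holds 0 or 1 threads
  data ThreadStep (χ : PortName → PortName) (E : Engine)
       : Thread → Heap → ELabel → List Thread → Heap → Set where
    s-new    : ∀ {i j k c ρ h p q} → h p ≡ nothing → read ρ j ≡ ptr q →
               ThreadStep χ E (new i j k ⨾ c , ρ) h τ
                 ((c , write ρ i (ptr p)) ∷ []) (h [ p ↦ just (q , read ρ k) ])
    s-get    : ∀ {i j k c ρ h p q d} → read ρ k ≡ ptr p → h p ≡ just (q , d) →
               ThreadStep χ E (get i j k ⨾ c , ρ) h τ
                 ((c , write (write ρ i (ptr q)) j d) ∷ []) h
    s-update : ∀ {i j c ρ h p q d} → read ρ i ≡ ptr p → h p ≡ just (q , d) →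
               ThreadStep χ E (update i j ⨾ c , ρ) h τ
                 ((c , ρ) ∷ []) (h [ p ↦ just (q , read ρ j) ])
    s-free   : ∀ {i c ρ h p v} → read ρ i ≡ ptr p → h p ≡ just v →
               ThreadStep χ E (free i ⨾ c , ρ) h τ
                 ((c , write ρ i ∅) ∷ []) (h [ p ↦ nothing ])
    s-flip   : ∀ {i j c ρ h} →
               ThreadStep χ E (flip i j ⨾ c , ρ) h τ
                 ((c , write (write ρ i (read ρ j)) j (read ρ i)) ∷ []) h
    s-set    : ∀ {i z c ρ h} →
               ThreadStep χ E (set i z ⨾ c , ρ) h τ
                 ((c , write ρ i (int z)) ∷ []) h
    s-if0    : ∀ {i c₁ c₂ ρ h} → read ρ i ≡ int (+ 0) →
               ThreadStep χ E (ifzero i c₁ c₂ , ρ) h τ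
                 ((c₁ , write ρ i ∅) ∷ []) h
    s-ifpos  : ∀ {i c₁ c₂ ρ h n} → read ρ i ≡ int (+ suc n) →
               ThreadStep χ E (ifzero i c₁ c₂ , ρ) h τ
                 ((c₂ , write ρ i ∅) ∷ []) h
    s-end    : ∀ {ρ h} → ThreadStep χ E (end , ρ) h τ [] h
    s-spark-in  : ∀ {a ρ h} → (O , χ a) ∈ iface E →
               ThreadStep χ E (spark a , ρ) h τ
                 ((prog E (χ a) , pad (takeM ρ)) ∷ []) h
    s-spark-out : ∀ {a ρ h} → ¬ ((O , χ a) ∈ iface E) →
               ThreadStep χ E (spark a , ρ) h (out (χ a , takeM ρ)) [] h

  -- engine configurations: finite multiset of threads (a list) and a heap
  EConf : Set
  EConf = List Thread × Heap

  data EStep (χ : PortName → PortName) (E : Engine) : EConf → ELabel → EConf → Set where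
    e-thread : ∀ {ts₁ t ts₂ h l ts h'} → ThreadStep χ E t h l ts h' →
               EStep χ E (ts₁ ++ t ∷ ts₂ , h) l (ts₁ ++ ts ++ ts₂ , h')
    e-input  : ∀ {ts h a d} → (O , a) ∈ iface E →
               EStep χ E (ts , h) (inp (a , d)) ((prog E a , pad d) ∷ ts , h)

  record Net : Set where
    constructor net
    field
      engines : List Engine
      conn    : PortName → PortName
      ext     : Interface
  open Net public

  Dom : Net → PortName → Set
  Dom S a = ((O , a) ∈ ext S) ⊎ ∃[ E ] (E ∈ engines S × (P , a) ∈ iface E)

  Cod : Net → PortName → Set
  Cod S a = ((P , a) ∈ ext S) ⊎ ∃[ E ] (E ∈ engines S × (O , a) ∈ iface E)

  Disjoint : Interface → Interface → Set
  Disjoint A B = ∀ a → a ∈sup A → a ∈sup B → ⊥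

  WFNet : Net → Set
  WFNet S =
      (∀ {E} → E ∈ engines S → WFEngine E)
    × WFInterface (ext S)
    × AllPairs (λ E F → Disjoint (iface E) (iface F)) (engines S)
    × (∀ {E} → E ∈ engines S → Disjoint (iface E) (ext S))
    × (∀ a → Dom S a → Cod S (conn S a))
    × (∀ a b → Dom S a → Dom S b → conn S a ≡ conn S b → a ≡ b)
    × (∀ b → Cod S b → ∃[ a ] (Dom S a × conn S a ≡ b))

  NetConf : Set
  NetConf = List EConf × List Msg

  -- a step of one of the engines (configurations aligned with engines)
  data EnginesStep (χ : PortName → PortName)
       : List Engine → List EConf → ELabel → List EConf → Set where
    here  : ∀ {E Es c cs l c'} → EStep χ E c l c' →
            EnginesStep χ (E ∷ Es) (c ∷ cs) l (c' ∷ cs)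
    there : ∀ {E Es c cs l cs'} → EnginesStep χ Es cs l cs' →
            EnginesStep χ (E ∷ Es) (c ∷ cs) l (c ∷ cs')

  PMsg : Set
  PMsg = Pol × Msg

  data NLabel : Set where
    silent : NLabel
    obs    : PMsg → NLabel

  data NStep (S : Net) : NetConf → NLabel → NetConf → Set where
    n-silent : ∀ {cs cs' ms} → EnginesStep (conn S) (engines S) cs τ cs' →
               NStep S (cs , ms) silent (cs' , ms)
    n-out    : ∀ {cs cs' ms m} → EnginesStep (conn S) (engines S) cs (out m) cs' →
               NStep S (cs , ms) silent (cs' , m ∷ ms)
    n-in     : ∀ {cs cs' ms₁ ms₂ m} → EnginesStep (conn S) (engines S) cs (inp m) cs' →
               NStep S (cs , ms₁ ++ m ∷ ms₂) silent (cs' , ms₁ ++ ms₂)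
    n-P      : ∀ {cs ms₁ ms₂ a d} → (P , a) ∈ ext S →
               NStep S (cs , ms₁ ++ (a , d) ∷ ms₂) (obs (P , (a , d))) (cs , ms₁ ++ ms₂)
    n-O      : ∀ {cs ms a d} → (O , a) ∈ ext S →
               NStep S (cs , ms) (obs (O , (a , d))) (cs , (conn S a , d) ∷ ms)

  Trace : Set
  Trace = List PMsg

  data Run (S : Net) : NetConf → Trace → Set where
    done   : ∀ {c} → Run S c []
    silent : ∀ {c c' t} → NStep S c silent c' → Run S c' t → Run S c t
    obsv   : ∀ {c c' α t} → NStep S c (obs α) c' → Run S c' t → Run S c (α ∷ t)

  initConf : Net → NetConf
  initConf S = (replicate (length (engines S)) ([] , emptyHeap)) , []

  ⟦_⟧ : Net → Trace → Set
  ⟦ S ⟧ t = Run S (initConf S) t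

  renTrace : Perm → Trace → Trace
  renTrace π = map (λ { (l , (a , d)) → (l , (app π a , d)) })

  _=𝔸T_ : (Trace → Set) → (Trace → Set) → Set
  T₁ =𝔸T T₂ = ∃[ π ] ((∀ s → T₁ s → T₂ (renTrace π s))
                    × (∀ t → T₂ t → ∃[ s ] (T₁ s × renTrace π s ≡ t)))

  StructEquiv : Net → Net → Set
  StructEquiv f g = ∃[ π ]
      ( EngSetEq (map (renEngine π) (engines f)) (engines g)
      × (π ⊢ ext f =𝔸 ext g)
      × (∀ a → Dom f a → conn g (app π a) ≡ app π (conn f a)) )

-- Renaming port names along π maps every run of S₁ step by step onto a run of S₂
-- whose observable trace is the π-renamed one: the configuration of the engine
-- owning an input port a of S₁ is sent to the configuration of the engine owning
-- π a in S₂. Sparks only go through the connection on P-ports of their own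
-- engine, where χ₂ ∘ π = π ∘ χ₁, and disjointness of interfaces makes the owner of
-- a port unique. Running the same argument with π⁻¹ gives the converse inclusion.
module Submission where

open import Defs
open import Data.Nat using (ℕ; zero; suc; _≤_; _<_; z≤n; s≤s)
open import Data.Nat.Properties using (_≟_)
open import Data.List using (List; []; _∷_; _++_; map; length; replicate)
open import Data.List.Properties using (map-++)
open import Data.List.Membership.Propositional using (_∈_)
open import Data.List.Membership.Propositional.Properties using (∈-map⁺; ∈-map⁻)
open import Data.List.Relation.Unary.Any using (here; there)
open import Data.List.Relation.Unary.All using (All; []; _∷_)
open import Data.List.Relation.Unary.All.Properties using (++⁺; ++⁻)
open import Data.List.Relation.Unary.AllPairs using (AllPairs; _∷_)
open import Data.List.Relation.Binary.Pointwise using (Pointwise; []; _∷_)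
open import Data.Maybe using (Maybe; just; nothing)
open import Data.Maybe.Properties using (just-injective)
open import Data.Product using (∃-syntax; _×_; _,_; proj₁; proj₂)
open import Data.Sum using (_⊎_; inj₁; inj₂)
open import Data.Empty using (⊥-elim)
open import Relation.Nullary using (yes; no)
open import Relation.Binary.PropositionalEquality
open import Function.Base using (_∘_)
open import Function.Bundles using (Inverse; Injection)
open import Function.Properties.Inverse using (↔-sym; ↔⇒↣)

private
  variable
    A B : Set

infix 5 _!?_
infixl 5 _[_]≔_

_!?_ : List A → ℕ → Maybe A
[]       !? _     = nothing
(x ∷ xs) !? zero  = just x
(x ∷ xs) !? suc n = xs !? n

_[_]≔_ : List A → ℕ → A → List A
[]       [ _     ]≔ _ = []
(x ∷ xs) [ zero  ]≔ y = y ∷ xs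
(x ∷ xs) [ suc n ]≔ y = x ∷ (xs [ n ]≔ y)

≔-!?-same : ∀ (xs : List A) n {x y} → xs !? n ≡ just x → (xs [ n ]≔ y) !? n ≡ just y
≔-!?-same (x ∷ xs) zero    _  = refl
≔-!?-same (x ∷ xs) (suc n) eq = ≔-!?-same xs n eq

≔-!?-other : ∀ (xs : List A) m n {y} → m ≢ n → (xs [ n ]≔ y) !? m ≡ xs !? m
≔-!?-other []       m       n       _   = refl
≔-!?-other (x ∷ xs) zero    zero    m≢n = ⊥-elim (m≢n refl)
≔-!?-other (x ∷ xs) zero    (suc n) _   = refl
≔-!?-other (x ∷ xs) (suc m) zero    _   = refl
≔-!?-other (x ∷ xs) (suc m) (suc n) m≢n = ≔-!?-other xs m n (λ e → m≢n (cong suc e))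

!?⇒∈ : ∀ (xs : List A) n {x} → xs !? n ≡ just x → x ∈ xs
!?⇒∈ (x ∷ xs) zero    refl = here refl
!?⇒∈ (x ∷ xs) (suc n) eq   = there (!?⇒∈ xs n eq)

∈⇒!? : ∀ {xs : List A} {x} → x ∈ xs → ∃[ n ] (xs !? n ≡ just x)
∈⇒!? (here refl) = zero , refl
∈⇒!? (there x∈)  = let n , eq = ∈⇒!? x∈ in suc n , eq

!?⇒<length : ∀ (xs : List A) n {x} → xs !? n ≡ just x → n < length xs
!?⇒<length (x ∷ xs) zero    _  = s≤s z≤n
!?⇒<length (x ∷ xs) (suc n) eq = s≤s (!?⇒<length xs n eq)

replicate-!?⁺ : ∀ {n i} {x : A} → i < n → replicate n x !? i ≡ just x
replicate-!?⁺ {i = zero}  (s≤s _)   = refl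
replicate-!?⁺ {i = suc i} (s≤s i<n) = replicate-!?⁺ i<n

replicate-!?⁻ : ∀ n i {x y : A} → replicate n x !? i ≡ just y → y ≡ x
replicate-!?⁻ (suc n) zero    refl = refl
replicate-!?⁻ (suc n) (suc i) eq   = replicate-!?⁻ n i eq

All-!? : ∀ {Q : A → Set} {xs : List A} n {x} → All Q xs → xs !? n ≡ just x → Q x
All-!? zero    (qx ∷ _)  refl = qx
All-!? (suc n) (_  ∷ qs) eq   = All-!? n qs eq

AllPairs-!? : ∀ {R : A → A → Set} {xs : List A} i j {x y} → AllPairs R xs →
              xs !? i ≡ just x → xs !? j ≡ just y → i ≢ j → R x y ⊎ R y x
AllPairs-!? zero    zero    _        _    _    i≢j = ⊥-elim (i≢j refl)
AllPairs-!? zero    (suc j) (rs ∷ _) refl eq   _   = inj₁ (All-!? j rs eq)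
AllPairs-!? (suc i) zero    (rs ∷ _) eq   refl _   = inj₂ (All-!? i rs eq)
AllPairs-!? (suc i) (suc j) (_ ∷ rp) eqx  eqy  i≢j = AllPairs-!? i j rp eqx eqy (λ e → i≢j (cong suc e))

Pointwise-!? : ∀ {R : A → B → Set} {xs ys} n {x y} → Pointwise R xs ys →
               xs !? n ≡ just x → ys !? n ≡ just y → R x y
Pointwise-!? zero    (rxy ∷ _) refl refl = rxy
Pointwise-!? (suc n) (_ ∷ rs)  eqx  eqy  = Pointwise-!? n rs eqx eqy

Pointwise-replicate : ∀ {R : A → B → Set} (xs : List A) {y} → (∀ x → R x y) →
                      Pointwise R xs (replicate (length xs) y)
Pointwise-replicate []       _   = []
Pointwise-replicate (x ∷ xs) Rxy = Rxy x ∷ Pointwise-replicate xs Rxy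

module _ (π : Perm) where

  app-unapp : ∀ a → app π (unapp π a) ≡ a
  app-unapp = Inverse.strictlyInverseˡ π

  unapp-app : ∀ a → unapp π (app π a) ≡ a
  unapp-app = Inverse.strictlyInverseʳ π

  ∈-renI⁺ : ∀ {I l a} → (l , a) ∈ I → (l , app π a) ∈ renI π I
  ∈-renI⁺ = ∈-map⁺ (renPort π)

  ∈-renI⁻ : ∀ {I l a} → (l , app π a) ∈ renI π I → (l , a) ∈ I
  ∈-renI⁻ m with ∈-map⁻ (renPort π) m
  ... | _ , m′ , e = subst₂ (λ l b → (l , b) ∈ _) (sym (cong proj₁ e))
                            (sym (Injection.injective (↔⇒↣ π) (cong proj₂ e))) m′

  ∈-renI-unapp : ∀ {I l a} → (l , a) ∈ renI π I → (l , unapp π a) ∈ I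
  ∈-renI-unapp {I} {l} {a} m = ∈-renI⁻ (subst (λ b → (l , b) ∈ renI π I) (sym (app-unapp a)) m)


module Invariance (r rm : ℕ) (rm≤r : rm ≤ r) where
  open HRAM r rm rm≤r

  renCode-unapp : ∀ π c → renCode (↔-sym π) (renCode π c) ≡ c
  renCode-unapp π (ι ⨾ c)          = cong (ι ⨾_) (renCode-unapp π c)
  renCode-unapp π (ifzero i c₁ c₂) = cong₂ (ifzero i) (renCode-unapp π c₁) (renCode-unapp π c₂)
  renCode-unapp π (spark a)        = cong spark (unapp-app π a)
  renCode-unapp π end              = refl

  renTrace-app-unapp : ∀ π t → renTrace π (renTrace (↔-sym π) t) ≡ t
  renTrace-app-unapp π []                  = refl
  renTrace-app-unapp π ((l , (a , d)) ∷ t) =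
    cong₂ _∷_ (cong (λ b → l , (b , d)) (app-unapp π a)) (renTrace-app-unapp π t)

  enginesStep-at : ∀ {χ Es cs l cs′} → EnginesStep χ Es cs l cs′ →
    ∃[ n ] ∃[ E ] ∃[ c ] ∃[ c′ ]
      (Es !? n ≡ just E) × (cs !? n ≡ just c) × EStep χ E c l c′ × (cs′ ≡ cs [ n ]≔ c′)
  enginesStep-at (here st) = zero , _ , _ , _ , refl , refl , st , refl
  enginesStep-at (there st) with enginesStep-at st
  ... | n , E , c , c′ , eE , ec , st′ , refl = suc n , E , c , c′ , eE , ec , st′ , refl

  enginesStep-≔ : ∀ {χ} (Es : List Engine) (cs : List EConf) n {E c l c′} →
    Es !? n ≡ just E → cs !? n ≡ just c → EStep χ E c l c′ → EnginesStep χ Es cs l (cs [ n ]≔ c′)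
  enginesStep-≔ (E ∷ Es) (c ∷ cs) zero    refl refl st = here st
  enginesStep-≔ (E ∷ Es) (c ∷ cs) (suc n) eE   ec   st = there (enginesStep-≔ Es cs n eE ec st)

  HasInputPort : Engine → Set
  HasInputPort E = ∃[ a ] ((O , a) ∈ iface E)

  SparksOutOf : Engine → Code → Set
  SparksOutOf E c = ∀ b → SparksIn b c → (P , b) ∈ iface E

  -- Every thread of E was started at an input port of E, so its code is a suffix
  -- of one of E's programs.
  ThreadOf : Engine → Thread → Set
  ThreadOf E t = HasInputPort E × SparksOutOf E (proj₁ t)

  program-threadOf : ∀ E {a} → WFEngine E → (O , a) ∈ iface E →
                     HasInputPort E × SparksOutOf E (prog E a)
  program-threadOf E {a} wf a∈ = (a , a∈) , (λ b → proj₂ wf a b a∈)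

  threadStep-threadOf : ∀ {χ E t h l ts h′} → WFEngine E → ThreadOf E t →
                        ThreadStep χ E t h l ts h′ → All (ThreadOf E) ts
  threadStep-threadOf _  ok      (s-new _ _)    = ok ∷ []
  threadStep-threadOf _  ok      (s-get _ _)    = ok ∷ []
  threadStep-threadOf _  ok      (s-update _ _) = ok ∷ []
  threadStep-threadOf _  ok      (s-free _ _)   = ok ∷ []
  threadStep-threadOf _  ok      s-flip         = ok ∷ []
  threadStep-threadOf _  ok      s-set          = ok ∷ []
  threadStep-threadOf _  (o , s) (s-if0 _)      = (o , (λ b → s b ∘ inj₁)) ∷ []
  threadStep-threadOf _  (o , s) (s-ifpos _)    = (o , (λ b → s b ∘ inj₂)) ∷ []
  threadStep-threadOf _  _       s-end          = []
  threadStep-threadOf {E = E} wf _ (s-spark-in m) = program-threadOf E wf m ∷ []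
  threadStep-threadOf _  _       (s-spark-out _) = []

  eStep-threadOf : ∀ {χ E c l c′} → WFEngine E → All (ThreadOf E) (proj₁ c) →
                   EStep χ E c l c′ → All (ThreadOf E) (proj₁ c′)
  eStep-threadOf wf oks (e-thread {ts₁} st) with ++⁻ ts₁ oks
  ... | oks₁ , ok ∷ oks₂ = ++⁺ oks₁ (++⁺ (threadStep-threadOf wf ok st) oks₂)
  eStep-threadOf {E = E} wf oks (e-input m) = program-threadOf E wf m ∷ oks

  eStep-hasInputPort : ∀ {χ E c l c′} → All (ThreadOf E) (proj₁ c) → EStep χ E c l c′ → HasInputPort E
  eStep-hasInputPort oks (e-thread {ts₁} _) with ++⁻ ts₁ oks
  ... | _ , ok ∷ _ = proj₁ ok
  eStep-hasInputPort _ (e-input {a = a} m) = a , m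

  WellSparked : List Engine → List EConf → Set
  WellSparked = Pointwise (λ E c → All (ThreadOf E) (proj₁ c))

  enginesStep-wellSparked : ∀ {χ Es cs l cs′} → (∀ {E} → E ∈ Es → WFEngine E) →
    WellSparked Es cs → EnginesStep χ Es cs l cs′ → WellSparked Es cs′
  enginesStep-wellSparked wf (oks ∷ okss) (here st)  = eStep-threadOf (wf (here refl)) oks st ∷ okss
  enginesStep-wellSparked wf (oks ∷ okss) (there st) =
    oks ∷ enginesStep-wellSparked (λ E∈ → wf (there E∈)) okss st

  module Renaming (π : Perm) where

    renThread : Thread → Thread
    renThread (c , ρ) = (renCode π c , ρ)

    renEConf : EConf → EConf
    renEConf (ts , h) = (map renThread ts , h)

    renMsg : Msg → Msg
    renMsg (a , d) = (app π a , d)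

    renELabel : ELabel → ELabel
    renELabel τ       = τ
    renELabel (out m) = out (renMsg m)
    renELabel (inp m) = inp (renMsg m)

    renNLabel : NLabel → NLabel
    renNLabel silent        = silent
    renNLabel (obs (l , m)) = obs (l , renMsg m)

    module _ (E : Engine) {F : Engine} (E≈F : EngEq (renEngine π E) F) where

      port⁺ : ∀ {l a} → (l , a) ∈ iface E → (l , app π a) ∈ iface F
      port⁺ a∈ = proj₁ (proj₁ E≈F) _ (∈-renI⁺ π a∈)

      port⁻ : ∀ {l a} → (l , app π a) ∈ iface F → (l , a) ∈ iface E
      port⁻ a∈ = ∈-renI⁻ π (proj₂ (proj₁ E≈F) _ a∈)

      prog-ren : ∀ {a} → (O , a) ∈ iface E → prog F (app π a) ≡ renCode π (prog E a)
      prog-ren {a} a∈ = begin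
        prog F (app π a)                       ≡⟨ sym (proj₂ E≈F (app π a) (∈-renI⁺ π a∈)) ⟩
        renCode π (prog E (unapp π (app π a))) ≡⟨ cong (renCode π ∘ prog E) (unapp-app π a) ⟩
        renCode π (prog E a)                   ∎
        where open ≡-Reasoning

      module _ {χ₁ χ₂ : PortName → PortName}
               (χ-ren : ∀ {a} → (P , a) ∈ iface E → χ₂ (app π a) ≡ app π (χ₁ a)) where

        threadStep-ren : ∀ {t h l ts h′} → ThreadOf E t → ThreadStep χ₁ E t h l ts h′ →
                         ThreadStep χ₂ F (renThread t) h (renELabel l) (map renThread ts) h′
        threadStep-ren _ (s-new e₁ e₂)    = s-new e₁ e₂
        threadStep-ren _ (s-get e₁ e₂)    = s-get e₁ e₂
        threadStep-ren _ (s-update e₁ e₂) = s-update e₁ e₂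
        threadStep-ren _ (s-free e₁ e₂)   = s-free e₁ e₂
        threadStep-ren _ s-flip           = s-flip
        threadStep-ren _ s-set            = s-set
        threadStep-ren _ (s-if0 e)        = s-if0 e
        threadStep-ren _ (s-ifpos e)      = s-ifpos e
        threadStep-ren _ s-end            = s-end
        threadStep-ren (_ , sparks) (s-spark-in {a} {ρ} {h} m) =
          subst (λ c → ThreadStep χ₂ F (spark (app π a) , ρ) h τ ((c , pad (takeM ρ)) ∷ []) h)
                (trans (cong (prog F) χa) (prog-ren m))
                (s-spark-in (subst (λ b → (O , b) ∈ iface F) (sym χa) (port⁺ m)))
          where χa = χ-ren (sparks a refl)
        threadStep-ren (_ , sparks) (s-spark-out {a} {ρ} {h} m∉) =
          subst (λ b → ThreadStep χ₂ F (spark (app π a) , ρ) h (out (b , takeM ρ)) [] h) χa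
                (s-spark-out (λ m → m∉ (port⁻ (subst (λ b → (O , b) ∈ iface F) χa m))))
          where χa = χ-ren (sparks a refl)

        eStep-ren : ∀ {c l c′} → All (ThreadOf E) (proj₁ c) → EStep χ₁ E c l c′ →
                    EStep χ₂ F (renEConf c) (renELabel l) (renEConf c′)
        eStep-ren oks (e-thread {ts₁} {t} {ts₂} {h} {l} {ts} {h′} st) with ++⁻ ts₁ oks
        ... | _ , ok ∷ _ =
          subst₂ (λ us vs → EStep χ₂ F (us , h) (renELabel l) (vs , h′))
            (sym (map-++ renThread ts₁ (t ∷ ts₂)))
            (sym (trans (map-++ renThread ts₁ (ts ++ ts₂))
                        (cong (map renThread ts₁ ++_) (map-++ renThread ts ts₂))))
            (e-thread (threadStep-ren ok st))
        eStep-ren _ (e-input {ts} {h} {a} {d} m) =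
          subst (λ c → EStep χ₂ F (map renThread ts , h) (inp (app π a , d)) ((c , pad d) ∷ map renThread ts , h))
            (prog-ren m) (e-input (port⁺ m))

  EnginesDisjoint : List Engine → Set
  EnginesDisjoint = AllPairs (λ E F → Disjoint (iface E) (iface F))

  wfNet-engines : ∀ {S} → WFNet S → ∀ {E} → E ∈ engines S → WFEngine E
  wfNet-engines = proj₁

  wfNet-disjoint : ∀ {S} → WFNet S → EnginesDisjoint (engines S)
  wfNet-disjoint wf = proj₁ (proj₂ (proj₂ wf))

  samePort⇒sameIndex : ∀ {Es i j E F a} → EnginesDisjoint Es → Es !? i ≡ just E → Es !? j ≡ just F →
                       a ∈sup iface E → a ∈sup iface F → i ≡ j
  samePort⇒sameIndex {i = i} {j} {a = a} disj eE eF a∈E a∈F with i ≟ j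
  ... | yes i≡j = i≡j
  ... | no i≢j with AllPairs-!? i j disj eE eF i≢j
  ...   | inj₁ E#F = ⊥-elim (E#F a a∈E a∈F)
  ...   | inj₂ F#E = ⊥-elim (F#E a a∈F a∈E)

  record NetRenaming (π : Perm) (f g : Net) : Set where
    field
      engine-ren : ∀ {E} → E ∈ engines f → ∃[ F ] (F ∈ engines g × EngEq (renEngine π E) F)
      ext-ren    : ∀ {l a} → (l , a) ∈ ext f → (l , app π a) ∈ ext g
      conn-ren   : ∀ {a} → Dom f a → conn g (app π a) ≡ app π (conn f a)

  module Simulation {π f g} (wf-f : WFNet f) (wf-g : WFNet g) (ren : NetRenaming π f g) where
    open Renaming π
    open NetRenaming ren

    -- Only engines with an input port are related: their partner in g is then unique
    -- by disjointness, and engines without one never leave the initial configuration.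
    Corresponds : List EConf → List EConf → Set
    Corresponds cs₁ cs₂ = ∀ {i j E F a c} → engines f !? i ≡ just E → engines g !? j ≡ just F →
      (O , a) ∈ iface E → (O , app π a) ∈ iface F → cs₁ !? i ≡ just c → cs₂ !? j ≡ just (renEConf c)

    corresponds-≔ : ∀ {cs₁ cs₂ i j E F c c′} → Corresponds cs₁ cs₂ →
      engines f !? i ≡ just E → engines g !? j ≡ just F → EngEq (renEngine π E) F →
      cs₁ !? i ≡ just c → cs₂ !? j ≡ just (renEConf c) →
      Corresponds (cs₁ [ i ]≔ c′) (cs₂ [ j ]≔ renEConf c′)
    corresponds-≔ {cs₁} {cs₂} {i} {j} {E} co eE eF E≈F ec ec₂ {i′} {j′} eE′ eF′ a∈E′ πa∈F′ ec′
      with i′ ≟ i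
    ... | yes refl with just-injective (trans (sym eE) eE′)
    ...   | refl with samePort⇒sameIndex (wfNet-disjoint wf-g) eF′ eF (O , πa∈F′) (O , port⁺ E E≈F a∈E′)
    ...     | refl with just-injective (trans (sym (≔-!?-same cs₁ i ec)) ec′)
    ...       | refl = ≔-!?-same cs₂ j ec₂
    corresponds-≔ {cs₁} {cs₂} {i} {j} {E} co eE eF E≈F ec ec₂ {i′} {j′} eE′ eF′ a∈E′ πa∈F′ ec′
      | no i′≢i =
      trans (≔-!?-other cs₂ j′ j j′≢j)
            (co eE′ eF′ a∈E′ πa∈F′ (trans (sym (≔-!?-other cs₁ i′ i i′≢i)) ec′))
      where
        j′≢j : j′ ≢ j
        j′≢j refl with just-injective (trans (sym eF) eF′)
        ... | refl = i′≢i (samePort⇒sameIndex (wfNet-disjoint wf-f) eE′ eE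
                                              (O , a∈E′) (O , port⁻ E E≈F πa∈F′))

    enginesStep-sim : ∀ {cs₁ cs₂ l cs₁′} → WellSparked (engines f) cs₁ → Corresponds cs₁ cs₂ →
      EnginesStep (conn f) (engines f) cs₁ l cs₁′ →
      ∃[ cs₂′ ] (EnginesStep (conn g) (engines g) cs₂ (renELabel l) cs₂′ × Corresponds cs₁′ cs₂′)
    enginesStep-sim {cs₁} {cs₂} ws co st with enginesStep-at st
    ... | i , E , c , c′ , eE , ec , est , refl =
      let oks          = Pointwise-!? i ws eE ec
          E∈           = !?⇒∈ (engines f) i eE
          a , a∈       = eStep-hasInputPort oks est
          F , F∈ , E≈F = engine-ren E∈
          j , eF       = ∈⇒!? F∈
          ec₂          = co eE eF a∈ (port⁺ E E≈F a∈) ec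
          est₂         = eStep-ren E E≈F (λ b∈ → conn-ren (inj₂ (E , E∈ , b∈))) oks est
      in cs₂ [ j ]≔ renEConf c′
       , enginesStep-≔ (engines g) cs₂ j eF ec₂ est₂
       , corresponds-≔ {cs₁} {cs₂} {c′ = c′} co eE eF E≈F ec ec₂

    record Related (c₁ c₂ : NetConf) : Set where
      constructor related
      field
        messages    : proj₂ c₂ ≡ map renMsg (proj₂ c₁)
        wellSparked : WellSparked (engines f) (proj₁ c₁)
        corresponds : Corresponds (proj₁ c₁) (proj₁ c₂)

    nStep-sim : ∀ {c₁ c₂ lab c₁′} → Related c₁ c₂ → NStep f c₁ lab c₁′ →
                ∃[ c₂′ ] (NStep g c₂ (renNLabel lab) c₂′ × Related c₁′ c₂′)
    nStep-sim (related refl ws co) (n-silent st) =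
      let cs₂′ , st₂ , co′ = enginesStep-sim ws co st
      in _ , n-silent st₂ , related refl (enginesStep-wellSparked (wfNet-engines wf-f) ws st) co′
    nStep-sim (related refl ws co) (n-out st) =
      let cs₂′ , st₂ , co′ = enginesStep-sim ws co st
      in _ , n-out st₂ , related refl (enginesStep-wellSparked (wfNet-engines wf-f) ws st) co′
    nStep-sim {c₂ = cs₂ , _} (related refl ws co) (n-in {ms₁ = xs} {ms₂ = ys} {m = m} st) =
      let cs₂′ , st₂ , co′ = enginesStep-sim ws co st
      in (cs₂′ , map renMsg xs ++ map renMsg ys)
       , subst (λ ms → NStep g (cs₂ , ms) silent (cs₂′ , map renMsg xs ++ map renMsg ys))
               (sym (map-++ renMsg xs (m ∷ ys))) (n-in st₂)
       , related (sym (map-++ renMsg xs ys)) (enginesStep-wellSparked (wfNet-engines wf-f) ws st) co′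
    nStep-sim {c₂ = cs₂ , _} (related refl ws co) (n-P {ms₁ = xs} {ms₂ = ys} {a} {d} a∈) =
      (cs₂ , map renMsg xs ++ map renMsg ys)
      , subst (λ ms → NStep g (cs₂ , ms) (obs (P , renMsg (a , d))) (cs₂ , map renMsg xs ++ map renMsg ys))
              (sym (map-++ renMsg xs ((a , d) ∷ ys))) (n-P (ext-ren a∈))
      , related (sym (map-++ renMsg xs ys)) ws co
    nStep-sim {c₂ = cs₂ , _} (related refl ws co) (n-O {ms = ms} {a} {d} a∈) =
      (cs₂ , (conn g (app π a) , d) ∷ map renMsg ms)
      , n-O (ext-ren a∈)
      , related (cong (λ b → (b , d) ∷ map renMsg ms) (conn-ren (inj₁ a∈))) ws co

    run-sim : ∀ {c₁ c₂ t} → Related c₁ c₂ → Run f c₁ t → Run g c₂ (renTrace π t)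
    run-sim rel done = done
    run-sim rel (silent st run) =
      let _ , st₂ , rel′ = nStep-sim rel st in silent st₂ (run-sim rel′ run)
    run-sim rel (obsv {α = _ , (_ , _)} st run) =
      let _ , st₂ , rel′ = nStep-sim rel st in obsv st₂ (run-sim rel′ run)

    related-init : Related (initConf f) (initConf g)
    related-init = related refl (Pointwise-replicate (engines f) (λ _ → [])) initial-corresponds
      where
        initial-corresponds : Corresponds (proj₁ (initConf f)) (proj₁ (initConf g))
        initial-corresponds {i} {j} eE eF _ _ ec
          rewrite replicate-!?⁻ (length (engines f)) i ec =
          replicate-!?⁺ (!?⇒<length (engines g) j eF)

    ⟦⟧-sim : ∀ {t} → ⟦ f ⟧ t → ⟦ g ⟧ (renTrace π t)
    ⟦⟧-sim = run-sim related-init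

  engEq-ren-sym : ∀ π {E F} → EngEq (renEngine π E) F → EngEq (renEngine (↔-sym π) F) E
  engEq-ren-sym π {E} {F} E≈F = (to-E , from-E) , prog-eq
    where
      open Renaming π
      to-E : ∀ p → p ∈ renI (↔-sym π) (iface F) → p ∈ iface E
      to-E _ m = port⁻ E E≈F (∈-renI-unapp (↔-sym π) m)
      from-E : ∀ p → p ∈ iface E → p ∈ renI (↔-sym π) (iface F)
      from-E (l , b) m = subst (λ b′ → (l , b′) ∈ renI (↔-sym π) (iface F)) (unapp-app π b)
                               (∈-renI⁺ (↔-sym π) (port⁺ E E≈F m))
      prog-eq : ∀ a → (O , a) ∈ renI (↔-sym π) (iface F) → renCode (↔-sym π) (prog F (app π a)) ≡ prog E a
      prog-eq a m = trans (cong (renCode (↔-sym π)) (prog-ren E E≈F (to-E _ m))) (renCode-unapp π (prog E a))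

  netRenaming : ∀ {f g} (se : StructEquiv f g) → NetRenaming (proj₁ se) f g
  netRenaming (π , (engines⊆ , _) , (ext⊆ , _) , conn-eq) = record
    { engine-ren = λ E∈ → engines⊆ _ (∈-map⁺ (renEngine π) E∈)
    ; ext-ren    = λ a∈ → ext⊆ _ (∈-renI⁺ π a∈)
    ; conn-ren   = conn-eq _
    }

  netRenaming⁻¹ : ∀ {f g} (se : StructEquiv f g) → NetRenaming (↔-sym (proj₁ se)) g f
  netRenaming⁻¹ {f} {g} (π , (_ , engines⊇) , (_ , ext⊇) , conn-eq) = record
    { engine-ren = engine-ren
    ; ext-ren    = λ a∈ → ∈-renI-unapp π (ext⊇ _ a∈)
    ; conn-ren   = conn-ren
    }
    where
      engine-ren : ∀ {F} → F ∈ engines g → ∃[ E ] (E ∈ engines f × EngEq (renEngine (↔-sym π) F) E)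
      engine-ren F∈ with engines⊇ _ F∈
      ... | _ , E′∈ , E′≈F with ∈-map⁻ (renEngine π) E′∈
      ...   | E , E∈ , refl = E , E∈ , engEq-ren-sym π E′≈F

      dom-unapp : ∀ {b} → Dom g b → Dom f (unapp π b)
      dom-unapp (inj₁ b∈)           = inj₁ (∈-renI-unapp π (ext⊇ _ b∈))
      dom-unapp (inj₂ (F , F∈ , b∈)) =
        let E , E∈ , F≈E = engine-ren F∈ in inj₂ (E , E∈ , Renaming.port⁺ (↔-sym π) F F≈E b∈)

      conn-ren : ∀ {b} → Dom g b → conn f (unapp π b) ≡ unapp π (conn g b)
      conn-ren {b} d = begin
        conn f (unapp π b)                        ≡⟨ sym (unapp-app π _) ⟩
        unapp π (app π (conn f (unapp π b)))      ≡⟨ cong (unapp π) (sym (conn-eq _ (dom-unapp d))) ⟩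
        unapp π (conn g (app π (unapp π b)))      ≡⟨ cong (unapp π ∘ conn g) (app-unapp π b) ⟩
        unapp π (conn g b)                        ∎
        where open ≡-Reasoning

  structEquiv⇒=𝔸T : ∀ {f g} → WFNet f → WFNet g → StructEquiv f g → ⟦ f ⟧ =𝔸T ⟦ g ⟧
  structEquiv⇒=𝔸T wf-f wf-g se@(π , _) =
    π , (λ _ → Simulation.⟦⟧-sim wf-f wf-g (netRenaming se))
      , (λ t run → renTrace (↔-sym π) t
                 , Simulation.⟦⟧-sim wf-g wf-f (netRenaming⁻¹ se) run
                 , renTrace-app-unapp π t)

theorem1 : (r rm : ℕ) (rm≤r : rm ≤ r) (S₁ S₂ : HRAM.Net r rm rm≤r) →
    HRAM.WFNet r rm rm≤r S₁ → HRAM.WFNet r rm rm≤r S₂ →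
    HRAM.StructEquiv r rm rm≤r S₁ S₂ →
    HRAM._=𝔸T_ r rm rm≤r (HRAM.⟦_⟧ r rm rm≤r S₁) (HRAM.⟦_⟧ r rm rm≤r S₂)
theorem1 r rm rm≤r _ _ = Invariance.structEquiv⇒=𝔸T r rm rm≤r
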